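{- For every $n\in\mathbb{N}$, the bases of the Dehn--Sommerville matroid $DS_{2n}$ are in bijection with the bases of $DS_{2n-1}$. More precisely, $DS_{2n}\cong DS_{2n-1}\oplus C$, where $C$ is a coloop; explicitly, $\{1,b_2,\dots,b_{n+1}\}\mapsto\{b_2-1,\dots,b_{n+1}-1\}$ (with $1<b_2<\dots<b_{n+1}$) is a bijection from the bases of $DS_{2n}$ to the bases of $DS_{2n-1}$.
   Context: Binomial coefficients satisfy $\binom{a}{b}=0$ if $b<0$ or $b>a$. For $d\in\mathbb{N}$, the Dehn--Sommerville matrix $M_d$ is the $(\lfloor d/2\rfloor+1)\times(d+1)$ rational matrix with rows indexed by $0\le i\le\lfloor d/2\rfloor$, columns indexed by $0\le j\le d$, and entries $(M_d)_{ij}=\binom{d+1-i}{d+1-j}-\binom{i}{d+1-j}$. Relabel the columns $1,\dots,d+1$. The Dehn--Sommerville matroid $DS_d$ is the matroid on $[d+1]$ whose bases are the sets $B$ of $\lfloor d/2\rfloor+1$ column labels whose corresponding maximal minor of $M_d$ is nonzero. A coloop is a matroid element lying in every basis; $\oplus$ denotes direct sum of matroids. -}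

module Defs where

open import Data.Nat using (ℕ; zero; suc; _∸_; ⌊_/2⌋)
open import Data.Nat.Combinatorics using (_C_)
open import Data.Integer using (ℤ; +_; _-_; _+_; _*_; -_; 0ℤ)
open import Data.Fin using (Fin; zero; suc; toℕ; punchIn)
open import Data.Bool using (Bool; true; false)
open import Data.Vec using ([]; _∷_)
open import Data.Fin.Subset using (Subset)
open import Data.Product using (Σ)
open import Relation.Binary.PropositionalEquality using (_≡_; _≢_; sym; subst)

rk : ℕ → ℕ
rk d = suc ⌊ d /2⌋

DSMatrix : (d : ℕ) → Fin (rk d) → Fin (suc d) → ℤ
DSMatrix d i j =
  (+ ((suc d ∸ toℕ i) C (suc d ∸ toℕ j))) - (+ (toℕ i C (suc d ∸ toℕ j)))

sumFin : (n : ℕ) → (Fin n → ℤ) → ℤ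
sumFin zero    f = 0ℤ
sumFin (suc n) f = f zero + sumFin n (λ j → f (suc j))

sgn : ℕ → ℤ
sgn zero          = + 1
sgn (suc zero)    = - (+ 1)
sgn (suc (suc k)) = sgn k

det : (n : ℕ) → (Fin n → Fin n → ℤ) → ℤ
det zero    A = + 1
det (suc n) A =
  sumFin (suc n) (λ j → sgn (toℕ j) * (A zero j * det n (λ r c → A (suc r) (punchIn j c))))

size : {m : ℕ} → Subset m → ℕ
size []          = 0
size (true ∷ p)  = suc (size p)
size (false ∷ p) = size p

cols : {m : ℕ} → (p : Subset m) → Fin (size p) → Fin m
cols (true ∷ p)  zero    = zero
cols (true ∷ p)  (suc k) = suc (cols p k)
cols (false ∷ p) k       = suc (cols p k)

-- B ⊆ [d+1] (columns 0..d, i.e. labels 1..d+1) is a basis of DS_d iff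
-- |B| = ⌊d/2⌋+1 and the corresponding maximal minor of M_d is nonzero
IsBasis : (d : ℕ) → Subset (suc d) → Set
IsBasis d B =
  Σ (size B ≡ rk d) λ e →
    det (rk d) (λ i k → DSMatrix d i (cols B (subst Fin (sym e) k))) ≢ 0ℤ

module Submission where

-- For n = m+1, a set b ∷ B of n+1 columns of M_{2n}
-- (b records label 1, B the labels 2, …, 2n+1 shifted down by one) is a basis of DS_{2n} iff
-- b holds and B is a basis of DS_{2n−1}.
--
-- The proof compares maximal minors.  Writing e(d,i,j) for the entries of M_d, the absorption
-- identity for binomial coefficients gives the recurrences
--   (j+1)·e(d+1, r+1, j+1) = (r+1)·e(d,r,j) + (d+1−r)·e(d,r+1,j),
--   (j+1)·e(d+1, 0,   j+1) = (d+2)·e(d,0,j).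
-- So after scaling column j+1 by j+1, each row of a minor of M_{2n} is a combination of two
-- consecutive rows of M_{2n−1}, whose row n vanishes, and row reduction removes the second term:
--  * with column 0, which is the unit vector e₀:  ∏(j+1)·det(minor of M_{2n}) = n!·det(minor of M_{2n−1});
--  * without column 0 the rows come from rows 0, 0, 1, …, n of M_{2n−1}, so the minor vanishes.

open import Defs

module Determinants where

  open import Data.Nat as ℕ using (ℕ; zero; suc; _≤_; _<_; _<?_)
  import Data.Nat.Properties as ℕP
  open import Data.Integer using (ℤ; +_; +[1+_]; -[1+_]; _-_; _+_; _*_; -_; 0ℤ)
  import Data.Integer.Properties as ℤP
  open import Data.Integer.Tactic.RingSolver using (solve-∀)
  open import Data.Fin using (Fin; zero; suc; toℕ; punchIn; fromℕ<)
  import Data.Fin.Properties as FinP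
  open import Data.Bool using (if_then_else_)
  open import Data.Sum using (_⊎_; inj₁; inj₂)
  open import Function using (_∘_)
  open import Relation.Nullary using (Dec; does; yes; no)
  open import Relation.Nullary.Decidable using (dec-true; dec-false)
  open import Relation.Binary.PropositionalEquality

  Matrix : ℕ → Set
  Matrix n = Fin n → Fin n → ℤ

  sumFin-cong : ∀ n {f g : Fin n → ℤ} → (∀ j → f j ≡ g j) → sumFin n f ≡ sumFin n g
  sumFin-cong zero    eq = refl
  sumFin-cong (suc n) eq = cong₂ _+_ (eq zero) (sumFin-cong n (eq ∘ suc))

  sumFin-zero : ∀ n {f : Fin n → ℤ} → (∀ j → f j ≡ 0ℤ) → sumFin n f ≡ 0ℤ
  sumFin-zero zero    eq = refl
  sumFin-zero (suc n) eq = cong₂ _+_ (eq zero) (sumFin-zero n (eq ∘ suc))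

  sumFin-linear : ∀ n (x y : ℤ) (f g : Fin n → ℤ) →
    sumFin n (λ j → x * f j + y * g j) ≡ x * sumFin n f + y * sumFin n g
  sumFin-linear zero    x y f g = zero-combination x y
    where
    zero-combination : ∀ (x y : ℤ) → 0ℤ ≡ x * 0ℤ + y * 0ℤ
    zero-combination = solve-∀
  sumFin-linear (suc n) x y f g =
    trans (cong (λ t → x * f zero + y * g zero + t) (sumFin-linear n x y (f ∘ suc) (g ∘ suc)))
          (regroup x y (f zero) (g zero) (sumFin n (f ∘ suc)) (sumFin n (g ∘ suc)))
    where
    regroup : ∀ (x y a b c d : ℤ) → (x * a + y * b) + (x * c + y * d) ≡ x * (a + c) + y * (b + d)
    regroup = solve-∀

  sumFin-scale : ∀ n (x : ℤ) (f : Fin n → ℤ) → sumFin n (λ j → x * f j) ≡ x * sumFin n f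
  sumFin-scale zero    x f = sym (ℤP.*-zeroʳ x)
  sumFin-scale (suc n) x f =
    trans (cong (λ t → x * f zero + t) (sumFin-scale n x (f ∘ suc)))
          (sym (ℤP.*-distribˡ-+ x (f zero) (sumFin n (f ∘ suc))))

  minor : ∀ {n} → Matrix (suc n) → Fin (suc n) → Matrix n
  minor A j r c = A (suc r) (punchIn j c)

  laplaceTerm : ∀ {n} → Matrix (suc n) → Fin (suc n) → ℤ
  laplaceTerm {n} A j = sgn (toℕ j) * (A zero j * det n (minor A j))

  laplaceTerm-entry-zero : ∀ {n} (A : Matrix (suc n)) j → A zero j ≡ 0ℤ → laplaceTerm A j ≡ 0ℤ
  laplaceTerm-entry-zero {n} A j eq =
    trans (cong (λ a → sgn (toℕ j) * (a * det n (minor A j))) eq) (ℤP.*-zeroʳ (sgn (toℕ j)))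

  laplaceTerm-minor-zero : ∀ {n} (A : Matrix (suc n)) j → det n (minor A j) ≡ 0ℤ → laplaceTerm A j ≡ 0ℤ
  laplaceTerm-minor-zero A j eq =
    trans (cong (λ d → sgn (toℕ j) * (A zero j * d)) eq)
          (trans (cong (sgn (toℕ j) *_) (ℤP.*-zeroʳ (A zero j))) (ℤP.*-zeroʳ (sgn (toℕ j))))

  det-cong : ∀ n {A B : Matrix n} → (∀ r c → A r c ≡ B r c) → det n A ≡ det n B
  det-cong zero    eq = refl
  det-cong (suc n) eq = sumFin-cong (suc n) λ j →
    cong (sgn (toℕ j) *_) (cong₂ _*_ (eq zero j) (det-cong n λ r c → eq (suc r) (punchIn j c)))

  det-linear-row : ∀ n (A B C : Matrix n) (r : Fin n) (x y : ℤ) →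
    (∀ c → A r c ≡ x * B r c + y * C r c) →
    (∀ s → s ≢ r → ∀ c → A s c ≡ B s c) →
    (∀ s → s ≢ r → ∀ c → A s c ≡ C s c) →
    det n A ≡ x * det n B + y * det n C
  det-linear-row (suc n) A B C zero x y row-r same-B same-C =
    trans (sumFin-cong (suc n) term) (sumFin-linear (suc n) x y (laplaceTerm B) (laplaceTerm C))
    where
    minorB≡minorC : ∀ j → det n (minor B j) ≡ det n (minor C j)
    minorB≡minorC j = det-cong n λ r c →
      trans (sym (same-B (suc r) (λ ()) (punchIn j c))) (same-C (suc r) (λ ()) (punchIn j c))
    distribute : ∀ (s x y b c d : ℤ) → s * ((x * b + y * c) * d) ≡ x * (s * (b * d)) + y * (s * (c * d))
    distribute = solve-∀
    term : ∀ j → laplaceTerm A j ≡ x * laplaceTerm B j + y * laplaceTerm C j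
    term j = begin
        sgn (toℕ j) * (A zero j * det n (minor A j))
      ≡⟨ cong₂ (λ a d → sgn (toℕ j) * (a * d)) (row-r j)
               (det-cong n λ r c → same-B (suc r) (λ ()) (punchIn j c)) ⟩
        sgn (toℕ j) * ((x * B zero j + y * C zero j) * det n (minor B j))
      ≡⟨ distribute (sgn (toℕ j)) x y (B zero j) (C zero j) (det n (minor B j)) ⟩
        x * laplaceTerm B j + y * (sgn (toℕ j) * (C zero j * det n (minor B j)))
      ≡⟨ cong (λ d → x * laplaceTerm B j + y * (sgn (toℕ j) * (C zero j * d))) (minorB≡minorC j) ⟩
        x * laplaceTerm B j + y * laplaceTerm C j
      ∎
      where open ≡-Reasoning
  det-linear-row (suc n) A B C (suc r) x y row-r same-B same-C =
    trans (sumFin-cong (suc n) term) (sumFin-linear (suc n) x y (laplaceTerm B) (laplaceTerm C))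
    where
    distribute : ∀ (s x y a p q : ℤ) → s * (a * (x * p + y * q)) ≡ x * (s * (a * p)) + y * (s * (a * q))
    distribute = solve-∀
    minor-linear : ∀ j → det n (minor A j) ≡ x * det n (minor B j) + y * det n (minor C j)
    minor-linear j = det-linear-row n (minor A j) (minor B j) (minor C j) r x y
      (λ c → row-r (punchIn j c))
      (λ s s≢r c → same-B (suc s) (s≢r ∘ FinP.suc-injective) (punchIn j c))
      (λ s s≢r c → same-C (suc s) (s≢r ∘ FinP.suc-injective) (punchIn j c))
    term : ∀ j → laplaceTerm A j ≡ x * laplaceTerm B j + y * laplaceTerm C j
    term j = begin
        sgn (toℕ j) * (A zero j * det n (minor A j))
      ≡⟨ cong₂ (λ a d → sgn (toℕ j) * (a * d)) (same-B zero (λ ()) j) (minor-linear j) ⟩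
        sgn (toℕ j) * (B zero j * (x * det n (minor B j) + y * det n (minor C j)))
      ≡⟨ distribute (sgn (toℕ j)) x y (B zero j) (det n (minor B j)) (det n (minor C j)) ⟩
        x * laplaceTerm B j + y * (sgn (toℕ j) * (B zero j * det n (minor C j)))
      ≡⟨ cong (λ a → x * laplaceTerm B j + y * (sgn (toℕ j) * (a * det n (minor C j))))
              (trans (sym (same-B zero (λ ()) j)) (same-C zero (λ ()) j)) ⟩
        x * laplaceTerm B j + y * laplaceTerm C j
      ∎
      where open ≡-Reasoning

  det-zero-row : ∀ n (A : Matrix n) (r : Fin n) → (∀ c → A r c ≡ 0ℤ) → det n A ≡ 0ℤ
  det-zero-row n A r zero-r =
    trans (det-linear-row n A A A r 0ℤ 0ℤ (λ c → trans (zero-r c) (zero-combination (A r c)))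
                          (λ _ _ _ → refl) (λ _ _ _ → refl))
          (zero-combination′ (det n A))
    where
    zero-combination : ∀ (a : ℤ) → 0ℤ ≡ 0ℤ * a + 0ℤ * a
    zero-combination = solve-∀
    zero-combination′ : ∀ (d : ℤ) → 0ℤ * d + 0ℤ * d ≡ 0ℤ
    zero-combination′ = solve-∀

  -- A matrix whose first column vanishes has determinant 0 (expanding along row 0, every
  -- minor except the first again has a zero first column).
  det-zero-first-column : ∀ n (A : Matrix (suc n)) → (∀ r → A r zero ≡ 0ℤ) → det (suc n) A ≡ 0ℤ

  minor-det-zero : ∀ {n} (A : Matrix (suc n)) (j : Fin n) →
    (∀ r → A (suc r) zero ≡ 0ℤ) → det n (minor A (suc j)) ≡ 0ℤ
  minor-det-zero {suc n} A j zero-below = det-zero-first-column n (minor A (suc j)) zero-below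

  det-zero-first-column n A zero-col = sumFin-zero (suc n) {laplaceTerm A} λ
    { zero    → laplaceTerm-entry-zero A zero (zero-col zero)
    ; (suc j) → laplaceTerm-minor-zero A (suc j) (minor-det-zero A j (zero-col ∘ suc)) }

  det-unit-first-column : ∀ n (A : Matrix (suc n)) → A zero zero ≡ + 1 → (∀ r → A (suc r) zero ≡ 0ℤ) →
    det (suc n) A ≡ det n (λ r c → A (suc r) (suc c))
  det-unit-first-column n A one zero-below = begin
      laplaceTerm A zero + sumFin n (laplaceTerm A ∘ suc)
    ≡⟨ cong₂ _+_ (cong (λ a → + 1 * (a * det n (minor A zero))) one)
                 (sumFin-zero n λ j → laplaceTerm-minor-zero A (suc j) (minor-det-zero A j zero-below)) ⟩
      + 1 * (+ 1 * det n (minor A zero)) + 0ℤ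
    ≡⟨ unit-factors (det n (minor A zero)) ⟩
      det n (minor A zero)
    ∎
    where
    open ≡-Reasoning
    unit-factors : ∀ (d : ℤ) → + 1 * (+ 1 * d) + 0ℤ ≡ d
    unit-factors = solve-∀

  prodFin : ∀ n → (Fin n → ℤ) → ℤ
  prodFin zero    w = + 1
  prodFin (suc n) w = w zero * prodFin n (w ∘ suc)

  prodFin-punchIn : ∀ n (w : Fin (suc n) → ℤ) (j : Fin (suc n)) →
    prodFin (suc n) w ≡ w j * prodFin n (w ∘ punchIn j)
  prodFin-punchIn n       w zero    = refl
  prodFin-punchIn (suc n) w (suc j) =
    trans (cong (w zero *_) (prodFin-punchIn n (w ∘ suc) j)) (swap (w zero) (w (suc j)) _)
    where
    swap : ∀ (a b c : ℤ) → a * (b * c) ≡ b * (a * c)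
    swap = solve-∀

  prodFin-nonzero : ∀ n (w : Fin n → ℤ) → (∀ j → w j ≢ 0ℤ) → prodFin n w ≢ 0ℤ
  prodFin-nonzero zero    w nz ()
  prodFin-nonzero (suc n) w nz eq with ℤP.i*j≡0⇒i≡0∨j≡0 (w zero) eq
  ... | inj₁ w0≡0   = nz zero w0≡0
  ... | inj₂ rest≡0 = prodFin-nonzero n (w ∘ suc) (nz ∘ suc) rest≡0

  det-scale-columns : ∀ n (A : Matrix n) (w : Fin n → ℤ) →
    det n (λ r c → A r c * w c) ≡ prodFin n w * det n A
  det-scale-columns zero    A w = refl
  det-scale-columns (suc n) A w =
    trans (sumFin-cong (suc n) term) (sumFin-scale (suc n) (prodFin (suc n) w) (laplaceTerm A))
    where
    regroup : ∀ (s a x p d : ℤ) → s * ((a * x) * (p * d)) ≡ (x * p) * (s * (a * d))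
    regroup = solve-∀
    term : ∀ j → laplaceTerm (λ r c → A r c * w c) j ≡ prodFin (suc n) w * laplaceTerm A j
    term j = begin
        sgn (toℕ j) * ((A zero j * w j) * det n (λ r c → A (suc r) (punchIn j c) * w (punchIn j c)))
      ≡⟨ cong (λ d → sgn (toℕ j) * ((A zero j * w j) * d)) (det-scale-columns n (minor A j) (w ∘ punchIn j)) ⟩
        sgn (toℕ j) * ((A zero j * w j) * (prodFin n (w ∘ punchIn j) * det n (minor A j)))
      ≡⟨ regroup (sgn (toℕ j)) (A zero j) (w j) _ _ ⟩
        (w j * prodFin n (w ∘ punchIn j)) * laplaceTerm A j
      ≡⟨ cong (_* laplaceTerm A j) (sym (prodFin-punchIn n w j)) ⟩
        prodFin (suc n) w * laplaceTerm A j
      ∎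
      where open ≡-Reasoning

  sgn-suc : ∀ k → sgn (suc k) ≡ - sgn k
  sgn-suc zero    = refl
  sgn-suc (suc k) = trans (sym (ℤP.neg-involutive (sgn k))) (cong -_ (sym (sgn-suc k)))

  self-negating : ∀ x → x ≡ - x → x ≡ 0ℤ
  self-negating (+ zero)  _  = refl
  self-negating +[1+ n ]  ()
  self-negating -[1+ n ]  ()

  Respects : ∀ {M N} → ((Fin M → Fin N) → ℤ) → Set
  Respects {M} {N} f = ∀ (e e′ : Fin M → Fin N) → (∀ c → e c ≡ e′ c) → f e ≡ f e′

  lift : ∀ {M N} → (Fin M → Fin N) → Fin (suc M) → Fin (suc N)
  lift e zero    = zero
  lift e (suc c) = suc (e c)

  lift-respects : ∀ {M N} (f : (Fin (suc M) → Fin (suc N)) → ℤ) → Respects f → Respects (f ∘ lift)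
  lift-respects f resp e e′ eq = resp (lift e) (lift e′) λ { zero → refl ; (suc c) → cong suc (eq c) }

  punchIn-suc-lift : ∀ {M} (j : Fin (suc (suc M))) (k : Fin (suc M)) (c : Fin (suc M)) →
    punchIn (suc j) (punchIn (suc k) c) ≡ lift (λ c → punchIn j (punchIn k c)) c
  punchIn-suc-lift j k zero    = refl
  punchIn-suc-lift j k (suc c) = refl

  -- Laplace expansion along the first two rows u, v of a matrix of size M+2: f e is the
  -- complementary minor on the columns selected by the embedding e.  By definition
  --   det (M+2) A = doubleExpansion M (A 0) (A 1) (λ e → det M (rows ≥ 2 of A restricted to e)).
  doubleExpansion : ∀ M (u v : Fin (suc (suc M)) → ℤ) → ((Fin M → Fin (suc (suc M))) → ℤ) → ℤ
  doubleExpansion M u v f = sumFin (suc (suc M)) λ j → sgn (toℕ j) * (u j *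
    sumFin (suc M) λ k → sgn (toℕ k) * (v (punchIn j k) * f (λ c → punchIn j (punchIn k c))))

  -- The part of a double expansion where the other row occupies column 0.
  expandAvoiding0 : ∀ M (w : Fin (suc (suc (suc M))) → ℤ) →
    ((Fin (suc M) → Fin (suc (suc (suc M)))) → ℤ) → ℤ
  expandAvoiding0 M w f = sumFin (suc (suc M)) λ k → sgn (toℕ k) * (w (suc k) * f (λ c → suc (punchIn k c)))

  doubleExpansion-split : ∀ M (u v : Fin (suc (suc (suc M))) → ℤ) f → Respects f →
    doubleExpansion (suc M) u v f ≡
    u zero * expandAvoiding0 M v f - v zero * expandAvoiding0 M u f
      + doubleExpansion M (u ∘ suc) (v ∘ suc) (f ∘ lift)
  doubleExpansion-split M u v f resp = begin
      + 1 * (u zero * expandAvoiding0 M v f)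
        + sumFin (suc (suc M)) (λ j → sgn (toℕ (suc j)) * (u (suc j) * inner (suc j)))
    ≡⟨ cong (λ t → + 1 * (u zero * expandAvoiding0 M v f) + t)
            (trans (sumFin-cong (suc (suc M)) later-term)
                   (sumFin-linear (suc (suc M)) (- v zero) (+ 1) (λ j → sgn (toℕ j) * (u (suc j) * F j))
                                                                (λ j → sgn (toℕ j) * (u (suc j) * rest j)))) ⟩
      + 1 * (u zero * expandAvoiding0 M v f) + (- v zero * expandAvoiding0 M u f + + 1 * R)
    ≡⟨ collect (u zero) (expandAvoiding0 M v f) (v zero) (expandAvoiding0 M u f) R ⟩
      u zero * expandAvoiding0 M v f - v zero * expandAvoiding0 M u f + R
    ∎
    where
    open ≡-Reasoning
    R : ℤ
    R = doubleExpansion M (u ∘ suc) (v ∘ suc) (f ∘ lift)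
    inner : Fin (suc (suc (suc M))) → ℤ
    inner j = sumFin (suc (suc M)) λ k → sgn (toℕ k) * (v (punchIn j k) * f (λ c → punchIn j (punchIn k c)))
    F : Fin (suc (suc M)) → ℤ
    F j = f (λ c → suc (punchIn j c))
    restTerm : Fin (suc (suc M)) → Fin (suc M) → ℤ
    restTerm j k = sgn (toℕ k) * (v (suc (punchIn j k)) * f (lift (λ c → punchIn j (punchIn k c))))
    rest : Fin (suc (suc M)) → ℤ
    rest j = sumFin (suc M) (restTerm j)
    negate-term : ∀ (s y : ℤ) → - s * y ≡ - + 1 * (s * y)
    negate-term = solve-∀
    tidy : ∀ (a r : ℤ) → + 1 * a + - + 1 * r ≡ a - r
    tidy = solve-∀
    inner-split : ∀ j → inner (suc j) ≡ v zero * F j - rest j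
    inner-split j = trans
      (cong (λ t → + 1 * (v zero * F j) + t)
        (trans (sumFin-cong (suc M) {g = λ k → - + 1 * restTerm j k} λ k →
                  trans (cong₂ (λ s t → s * (v (suc (punchIn j k)) * t)) (sgn-suc (toℕ k))
                               (resp _ _ (punchIn-suc-lift j k)))
                        (negate-term (sgn (toℕ k)) _))
               (sumFin-scale (suc M) (- + 1) (restTerm j))))
      (tidy (v zero * F j) (rest j))
    expand : ∀ (s a v0 F r : ℤ) → - s * (a * (v0 * F - r)) ≡ - v0 * (s * (a * F)) + + 1 * (s * (a * r))
    expand = solve-∀
    later-term : ∀ j → sgn (toℕ (suc j)) * (u (suc j) * inner (suc j))
                       ≡ - v zero * (sgn (toℕ j) * (u (suc j) * F j)) + + 1 * (sgn (toℕ j) * (u (suc j) * rest j))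
    later-term j = trans (cong₂ (λ s t → s * (u (suc j) * t)) (sgn-suc (toℕ j)) (inner-split j))
                         (expand (sgn (toℕ j)) (u (suc j)) (v zero) (F j) (rest j))
    collect : ∀ (u0 Sv v0 Su R : ℤ) → + 1 * (u0 * Sv) + (- v0 * Su + + 1 * R) ≡ u0 * Sv - v0 * Su + R
    collect = solve-∀

  doubleExpansion-cong₁ : ∀ M {u u′ : Fin (suc (suc M)) → ℤ} v f → (∀ j → u j ≡ u′ j) →
    doubleExpansion M u v f ≡ doubleExpansion M u′ v f
  doubleExpansion-cong₁ M v f eq = sumFin-cong (suc (suc M)) λ j →
    cong (λ a → sgn (toℕ j) * (a * sumFin (suc M) λ k →
           sgn (toℕ k) * (v (punchIn j k) * f (λ c → punchIn j (punchIn k c))))) (eq j)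

  doubleExpansion-antisymmetric : ∀ M (u v : Fin (suc (suc M)) → ℤ) f → Respects f →
    doubleExpansion M u v f ≡ - doubleExpansion M v u f
  -- For M = 0 both complementary minors are on no columns, hence equal, and the claim is the
  -- 2×2 identity u₀v₁ − u₁v₀ = −(v₀u₁ − v₁u₀); for M+1 split off column 0 and recurse.
  doubleExpansion-antisymmetric zero u v f resp
    rewrite resp (λ c → punchIn (suc zero) (punchIn zero c)) (λ c → punchIn zero (punchIn zero c)) (λ ())
    = two-by-two (u zero) (u (suc zero)) (v zero) (v (suc zero)) _
    where
    two-by-two : ∀ (u0 u1 v0 v1 a : ℤ) →
      + 1 * (u0 * (+ 1 * (v1 * a) + 0ℤ)) + (- + 1 * (u1 * (+ 1 * (v0 * a) + 0ℤ)) + 0ℤ)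
      ≡ - (+ 1 * (v0 * (+ 1 * (u1 * a) + 0ℤ)) + (- + 1 * (v1 * (+ 1 * (u0 * a) + 0ℤ)) + 0ℤ))
    two-by-two = solve-∀
  doubleExpansion-antisymmetric (suc M) u v f resp = begin
      doubleExpansion (suc M) u v f
    ≡⟨ doubleExpansion-split M u v f resp ⟩
      u zero * Sv - v zero * Su + doubleExpansion M (u ∘ suc) (v ∘ suc) (f ∘ lift)
    ≡⟨ cong (λ t → u zero * Sv - v zero * Su + t)
            (doubleExpansion-antisymmetric M (u ∘ suc) (v ∘ suc) (f ∘ lift) (lift-respects f resp)) ⟩
      u zero * Sv - v zero * Su + - doubleExpansion M (v ∘ suc) (u ∘ suc) (f ∘ lift)
    ≡⟨ negate (u zero) Sv (v zero) Su _ ⟩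
      - (v zero * Su - u zero * Sv + doubleExpansion M (v ∘ suc) (u ∘ suc) (f ∘ lift))
    ≡⟨ cong -_ (sym (doubleExpansion-split M v u f resp)) ⟩
      - doubleExpansion (suc M) v u f
    ∎
    where
    open ≡-Reasoning
    Sv Su : ℤ
    Sv = expandAvoiding0 M v f
    Su = expandAvoiding0 M u f
    negate : ∀ (u0 Sv v0 Su R : ℤ) → u0 * Sv - v0 * Su + - R ≡ - (v0 * Su - u0 * Sv + R)
    negate = solve-∀

  -- A matrix with two equal adjacent rows i, i+1 has determinant 0: for rows 0 and 1 by
  -- antisymmetry of the double expansion, otherwise by induction through the row-0 expansion.
  det-equal-adjacent-rows : ∀ n (A : Matrix n) (i j : Fin n) → toℕ j ≡ suc (toℕ i) →
    (∀ c → A i c ≡ A j c) → det n A ≡ 0ℤ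
  det-equal-adjacent-rows (suc (suc M)) A zero (suc zero) _ same = begin
      doubleExpansion M (A zero) (A (suc zero)) rest
    ≡⟨ doubleExpansion-cong₁ M (A (suc zero)) rest same ⟩
      doubleExpansion M (A (suc zero)) (A (suc zero)) rest
    ≡⟨ self-negating _ (doubleExpansion-antisymmetric M (A (suc zero)) (A (suc zero)) rest rest-respects) ⟩
      0ℤ
    ∎
    where
    open ≡-Reasoning
    rest : (Fin M → Fin (suc (suc M))) → ℤ
    rest e = det M (λ r c → A (suc (suc r)) (e c))
    rest-respects : Respects rest
    rest-respects e e′ eq = det-cong M λ r c → cong (A (suc (suc r))) (eq c)
  det-equal-adjacent-rows (suc (suc M)) A zero (suc (suc j)) ()
  det-equal-adjacent-rows (suc n) A (suc i) (suc j) j≡i+1 same =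
    sumFin-zero (suc n) {laplaceTerm A} λ k → laplaceTerm-minor-zero A k
      (det-equal-adjacent-rows n (minor A k) i j (ℕP.suc-injective j≡i+1) (same ∘ punchIn k))

  -- The product ∏_{r<k} b r, built from the top so that stage k+1 multiplies by b k.
  prodUpTo : ℕ → (ℕ → ℤ) → ℤ
  prodUpTo zero    b = + 1
  prodUpTo (suc k) b = prodUpTo k b * b k

  prodUpTo-nonzero : ∀ k (b : ℕ → ℤ) → (∀ r → r < k → b r ≢ 0ℤ) → prodUpTo k b ≢ 0ℤ
  prodUpTo-nonzero zero    b nz ()
  prodUpTo-nonzero (suc k) b nz eq with ℤP.i*j≡0⇒i≡0∨j≡0 (prodUpTo k b) eq
  ... | inj₁ prefix≡0 = prodUpTo-nonzero k b (λ r r<k → nz r (ℕP.m<n⇒m<1+n r<k)) prefix≡0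
  ... | inj₂ bk≡0     = nz k (ℕP.n<1+n k) bk≡0

  replaceRow : ∀ {n} → Matrix n → Fin n → (Fin n → ℤ) → Matrix n
  replaceRow A i v s = if does (s FinP.≟ i) then v else A s

  replaceRow-at : ∀ {n} (A : Matrix n) i v → replaceRow A i v i ≡ v
  replaceRow-at A i v = cong (if_then v else A i) (dec-true (i FinP.≟ i) refl)

  replaceRow-off : ∀ {n} (A : Matrix n) i v s → s ≢ i → replaceRow A i v s ≡ A s
  replaceRow-off A i v s s≢i = cong (if_then v else A s) (dec-false (s FinP.≟ i) s≢i)

  -- Let g 0, …, g n be rows with
  -- g n = 0 and let row r of H be  b r · g r + a r · g (r+1).  Then det H = (∏ b) · det G,
  -- where G has rows g 0, …, g (n-1).  The rows are transformed one at a time, top to bottom: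
  -- in stage k the rows r < k are already those of H.
  module RowReduction {n} (g : ℕ → Fin n → ℤ) (a b : ℕ → ℤ) (g-last : ∀ c → g n c ≡ 0ℤ) where

    combined : ℕ → Fin n → ℤ
    combined r c = b r * g r c + a r * g (suc r) c

    G H : Matrix n
    G r = g (toℕ r)
    H r = combined (toℕ r)

    stage : ℕ → Matrix n
    stage k r = if does (toℕ r <? k) then combined (toℕ r) else g (toℕ r)

    stage-below : ∀ k r → toℕ r < k → stage k r ≡ combined (toℕ r)
    stage-below k r r<k = cong (if_then combined (toℕ r) else g (toℕ r)) (dec-true (toℕ r <? k) r<k)

    stage-above : ∀ k r → k ≤ toℕ r → stage k r ≡ g (toℕ r)
    stage-above k r k≤r = cong (if_then combined (toℕ r) else g (toℕ r)) (dec-false (toℕ r <? k) (ℕP.≤⇒≯ k≤r))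

    stage-step-off : ∀ k r → toℕ r ≢ k → stage (suc k) r ≡ stage k r
    stage-step-off k r r≢k = by-cases (toℕ r <? k)
      where
      by-cases : Dec (toℕ r < k) → stage (suc k) r ≡ stage k r
      by-cases (yes r<k) = trans (stage-below (suc k) r (ℕP.m<n⇒m<1+n r<k)) (sym (stage-below k r r<k))
      by-cases (no r≮k)  = trans (stage-above (suc k) r (ℕP.≤∧≢⇒< k≤r (r≢k ∘ sym))) (sym (stage-above k r k≤r))
        where
        k≤r : k ≤ toℕ r
        k≤r = ℕP.≮⇒≥ r≮k

    -- Replacing row k of stage k by g (k+1) gives a singular matrix: the new row repeats row k+1,
    -- which is still g (k+1), or, when k+1 = n, it is the vanishing row g n.
    replaced-singular : ∀ k (k<n : k < n) → det n (replaceRow (stage k) (fromℕ< k<n) (g (suc k))) ≡ 0ℤ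
    replaced-singular k k<n = by-cases (ℕP.m≤n⇒m<n∨m≡n k<n)
      where
      i : Fin n
      i = fromℕ< k<n
      i≡k : toℕ i ≡ k
      i≡k = FinP.toℕ-fromℕ< k<n
      C : Matrix n
      C = replaceRow (stage k) i (g (suc k))
      C-at-i : ∀ c → C i c ≡ g (suc k) c
      C-at-i = cong-app (replaceRow-at (stage k) i (g (suc k)))
      by-cases : suc k < n ⊎ suc k ≡ n → det n C ≡ 0ℤ
      by-cases (inj₂ 1+k≡n) = det-zero-row n C i λ c →
        trans (C-at-i c) (subst (λ t → g t c ≡ 0ℤ) (sym 1+k≡n) (g-last c))
      by-cases (inj₁ 1+k<n) = det-equal-adjacent-rows n C i i′ (trans i′≡1+k (cong suc (sym i≡k))) λ c →
        trans (C-at-i c) (sym (C-at-i′ c))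
        where
        i′ : Fin n
        i′ = fromℕ< 1+k<n
        i′≡1+k : toℕ i′ ≡ suc k
        i′≡1+k = FinP.toℕ-fromℕ< 1+k<n
        i′≢i : i′ ≢ i
        i′≢i i′≡i = ℕP.1+n≢n (trans (sym i′≡1+k) (trans (cong toℕ i′≡i) i≡k))
        C-at-i′ : ∀ c → C i′ c ≡ g (suc k) c
        C-at-i′ c = begin
            C i′ c
          ≡⟨ cong-app (replaceRow-off (stage k) i (g (suc k)) i′ i′≢i) c ⟩
            stage k i′ c
          ≡⟨ cong-app (stage-above k i′ (subst (k ≤_) (sym i′≡1+k) (ℕP.n≤1+n k))) c ⟩
            g (toℕ i′) c
          ≡⟨ cong (λ t → g t c) i′≡1+k ⟩
            g (suc k) c
          ∎
          where open ≡-Reasoning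

    -- Passing from stage k to stage k+1 multiplies the determinant by b k: by linearity in row k
    -- the a k-part is the singular matrix of replaced-singular.
    stage-step : ∀ k → k < n → det n (stage (suc k)) ≡ b k * det n (stage k)
    stage-step k k<n = begin
        det n (stage (suc k))
      ≡⟨ det-linear-row n (stage (suc k)) (stage k) C i (b k) (a k) row-i same-stage same-C ⟩
        b k * det n (stage k) + a k * det n C
      ≡⟨ cong (λ d → b k * det n (stage k) + a k * d) (replaced-singular k k<n) ⟩
        b k * det n (stage k) + a k * 0ℤ
      ≡⟨ drop-zero (b k) (a k) (det n (stage k)) ⟩
        b k * det n (stage k)
      ∎
      where
      open ≡-Reasoning
      i : Fin n
      i = fromℕ< k<n
      i≡k : toℕ i ≡ k
      i≡k = FinP.toℕ-fromℕ< k<n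
      C : Matrix n
      C = replaceRow (stage k) i (g (suc k))
      row-i : ∀ c → stage (suc k) i c ≡ b k * stage k i c + a k * C i c
      row-i c = begin
          stage (suc k) i c
        ≡⟨ cong-app (stage-below (suc k) i (ℕ.s≤s (ℕP.≤-reflexive i≡k))) c ⟩
          combined (toℕ i) c
        ≡⟨ cong (λ t → combined t c) i≡k ⟩
          b k * g k c + a k * g (suc k) c
        ≡⟨ sym (cong₂ (λ x y → b k * x + a k * y) stage-at-i (cong-app (replaceRow-at (stage k) i (g (suc k))) c)) ⟩
          b k * stage k i c + a k * C i c
        ∎
        where
        stage-at-i : stage k i c ≡ g k c
        stage-at-i = trans (cong-app (stage-above k i (ℕP.≤-reflexive (sym i≡k))) c) (cong (λ t → g t c) i≡k)
      same-stage : ∀ s → s ≢ i → ∀ c → stage (suc k) s c ≡ stage k s c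
      same-stage s s≢i c =
        cong-app (stage-step-off k s (s≢i ∘ FinP.toℕ-injective ∘ λ s≡k → trans s≡k (sym i≡k))) c
      same-C : ∀ s → s ≢ i → ∀ c → stage (suc k) s c ≡ C s c
      same-C s s≢i c =
        trans (same-stage s s≢i c) (sym (cong-app (replaceRow-off (stage k) i (g (suc k)) s s≢i) c))
      drop-zero : ∀ (x y d : ℤ) → x * d + y * 0ℤ ≡ x * d
      drop-zero = solve-∀

    stage-det : ∀ k → k ℕ.≤ n → det n (stage k) ≡ prodUpTo k b * det n G
    stage-det zero    _     =
      trans (det-cong n λ r c → cong-app (stage-above zero r ℕ.z≤n) c) (sym (ℤP.*-identityˡ (det n G)))
    stage-det (suc k) 1+k≤n = begin
        det n (stage (suc k))
      ≡⟨ stage-step k 1+k≤n ⟩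
        b k * det n (stage k)
      ≡⟨ cong (b k *_) (stage-det k (ℕP.<⇒≤ 1+k≤n)) ⟩
        b k * (prodUpTo k b * det n G)
      ≡⟨ reorder (b k) (prodUpTo k b) (det n G) ⟩
        prodUpTo (suc k) b * det n G
      ∎
      where
      open ≡-Reasoning
      reorder : ∀ (x p d : ℤ) → x * (p * d) ≡ (p * x) * d
      reorder = solve-∀

    det-bidiagonal : det n H ≡ prodUpTo n b * det n G
    det-bidiagonal =
      trans (det-cong n λ r c → sym (cong-app (stage-below n r (FinP.toℕ<n r)) c)) (stage-det n ℕP.≤-refl)

module Binomials where

  open import Data.Nat as ℕ using (ℕ; zero; suc; z≤n; s≤s)
  import Data.Nat.Properties as ℕP
  open import Data.Nat.Combinatorics using (_C_; nCk+nC[k+1]≡[n+1]C[k+1]; k>n⇒nCk≡0; nC1≡n)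
  import Data.Nat.Tactic.RingSolver as ℕSolver
  open import Data.Integer using (ℤ; +_; _-_; _+_; _*_)
  import Data.Integer.Properties as ℤP
  open import Data.Integer.Tactic.RingSolver using (solve-∀)
  open import Relation.Binary.PropositionalEquality

  absorption : ∀ n k → suc k ℕ.* (suc n C suc k) ≡ suc n ℕ.* (n C k)
  absorption zero    zero    = refl
  absorption zero    (suc k) =
    trans (cong (suc (suc k) ℕ.*_) (k>n⇒nCk≡0 {1} {suc (suc k)} (s≤s (s≤s z≤n))))
          (trans (ℕP.*-zeroʳ (suc (suc k)))
                 (sym (trans (ℕP.+-identityʳ (0 C suc k)) (k>n⇒nCk≡0 {0} {suc k} (s≤s z≤n)))))
  absorption (suc n) zero    =
    trans (ℕP.+-identityʳ _) (trans (nC1≡n (suc (suc n))) (sym (ℕP.*-identityʳ (suc (suc n)))))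
  absorption (suc n) (suc k) = begin
      suc (suc k) ℕ.* (suc (suc n) C suc (suc k))
    ≡⟨ cong (suc (suc k) ℕ.*_) (sym (nCk+nC[k+1]≡[n+1]C[k+1] (suc n) (suc k))) ⟩
      suc (suc k) ℕ.* (x ℕ.+ y)
    ≡⟨ spread k x y ⟩
      x ℕ.+ suc k ℕ.* x ℕ.+ suc (suc k) ℕ.* y
    ≡⟨ cong₂ (λ s t → x ℕ.+ s ℕ.+ t) (absorption n k) (absorption n (suc k)) ⟩
      x ℕ.+ suc n ℕ.* (n C k) ℕ.+ suc n ℕ.* (n C suc k)
    ≡⟨ collect x (suc n) (n C k) (n C suc k) ⟩
      x ℕ.+ suc n ℕ.* (n C k ℕ.+ n C suc k)
    ≡⟨ cong (λ t → x ℕ.+ suc n ℕ.* t) (nCk+nC[k+1]≡[n+1]C[k+1] n k) ⟩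
      x ℕ.+ suc n ℕ.* x
    ∎
    where
    open ≡-Reasoning
    x y : ℕ
    x = suc n C suc k
    y = suc n C suc (suc k)
    spread : ∀ (k a b : ℕ) → suc (suc k) ℕ.* (a ℕ.+ b) ≡ a ℕ.+ suc k ℕ.* a ℕ.+ suc (suc k) ℕ.* b
    spread = ℕSolver.solve-∀
    collect : ∀ (a N p q : ℕ) → a ℕ.+ N ℕ.* p ℕ.+ N ℕ.* q ≡ a ℕ.+ N ℕ.* (p ℕ.+ q)
    collect = ℕSolver.solve-∀

  -- Absorption in the form (n+1)·C(n,K) + K·C(n+1,K) = (n+1)·C(n+1,K), i.e.
  -- (n+1)·C(n,K) = (n+1−K)·C(n+1,K), stated without truncated subtraction.
  absorption-sum : ∀ n K → suc n ℕ.* (n C K) ℕ.+ K ℕ.* (suc n C K) ≡ suc n ℕ.* (suc n C K)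
  absorption-sum n zero    = ℕP.+-identityʳ _
  absorption-sum n (suc k) = begin
      suc n ℕ.* (n C suc k) ℕ.+ suc k ℕ.* (suc n C suc k)
    ≡⟨ cong (suc n ℕ.* (n C suc k) ℕ.+_) (absorption n k) ⟩
      suc n ℕ.* (n C suc k) ℕ.+ suc n ℕ.* (n C k)
    ≡⟨ sym (ℕP.*-distribˡ-+ (suc n) (n C suc k) (n C k)) ⟩
      suc n ℕ.* (n C suc k ℕ.+ n C k)
    ≡⟨ cong (suc n ℕ.*_) (trans (ℕP.+-comm (n C suc k) (n C k)) (nCk+nC[k+1]≡[n+1]C[k+1] n k)) ⟩
      suc n ℕ.* (suc n C suc k)
    ∎
    where open ≡-Reasoning

  absorption-sumℤ : ∀ n K → + suc n * + (n C K) + + K * + (suc n C K) ≡ + suc n * + (suc n C K)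
  absorption-sumℤ n K = begin
      + suc n * + (n C K) + + K * + (suc n C K)
    ≡⟨ sym (cong₂ _+_ (ℤP.pos-* (suc n) (n C K)) (ℤP.pos-* K (suc n C K))) ⟩
      + (suc n ℕ.* (n C K)) + + (K ℕ.* (suc n C K))
    ≡⟨ sym (ℤP.pos-+ (suc n ℕ.* (n C K)) (K ℕ.* (suc n C K))) ⟩
      + (suc n ℕ.* (n C K) ℕ.+ K ℕ.* (suc n C K))
    ≡⟨ cong +_ (absorption-sum n K) ⟩
      + (suc n ℕ.* (suc n C K))
    ≡⟨ ℤP.pos-* (suc n) (suc n C K) ⟩
      + suc n * + (suc n C K)
    ∎
    where open ≡-Reasoning

  pos-difference : ∀ J K S → J ℕ.+ K ≡ S → + J ≡ + S - + K
  pos-difference J K S J+K≡S = begin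
      + J
    ≡⟨ sym (add-sub (+ J) (+ K)) ⟩
      + J + + K - + K
    ≡⟨ cong (_- + K) (trans (sym (ℤP.pos-+ J K)) (cong +_ J+K≡S)) ⟩
      + S - + K
    ∎
    where
    open ≡-Reasoning
    add-sub : ∀ (a b : ℤ) → a + b - b ≡ a
    add-sub = solve-∀

  -- It is a linear combination of the absorption identities for C(r,K) and C(p,K).
  binomial-difference : ∀ p r K J → J ℕ.+ K ≡ suc p ℕ.+ suc r →
    (+ (suc p C K) - + (suc r C K)) * + J
      ≡ + suc r * (+ (suc p C K) - + (r C K)) + + suc p * (+ (p C K) - + (suc r C K))
  binomial-difference p r K J J+K≡ = begin
      (Xp′ - Xr′) * + J
    ≡⟨ cong ((Xp′ - Xr′) *_) (trans (pos-difference J K _ J+K≡) (cong (_- k) (ℤP.pos-+ (suc p) (suc r)))) ⟩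
      (Xp′ - Xr′) * (P + R - k)
    ≡⟨ expand P R k Xp Xp′ Xr Xr′ ⟩
      R * (Xp′ - Xr) + P * (Xp - Xr′) + ((R * Xr + k * Xr′) - R * Xr′) - ((P * Xp + k * Xp′) - P * Xp′)
    ≡⟨ cong₂ (λ s t → R * (Xp′ - Xr) + P * (Xp - Xr′) + (s - R * Xr′) - (t - P * Xp′))
             (absorption-sumℤ r K) (absorption-sumℤ p K) ⟩
      R * (Xp′ - Xr) + P * (Xp - Xr′) + (R * Xr′ - R * Xr′) - (P * Xp′ - P * Xp′)
    ≡⟨ cancel (R * (Xp′ - Xr) + P * (Xp - Xr′)) (R * Xr′) (P * Xp′) ⟩
      R * (Xp′ - Xr) + P * (Xp - Xr′)
    ∎
    where
    open ≡-Reasoning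
    P R k Xp Xp′ Xr Xr′ : ℤ
    P = + suc p
    R = + suc r
    k = + K
    Xp = + (p C K)
    Xp′ = + (suc p C K)
    Xr = + (r C K)
    Xr′ = + (suc r C K)
    expand : ∀ (P R k Xp Xp′ Xr Xr′ : ℤ) → (Xp′ - Xr′) * (P + R - k)
      ≡ R * (Xp′ - Xr) + P * (Xp - Xr′) + ((R * Xr + k * Xr′) - R * Xr′) - ((P * Xp + k * Xp′) - P * Xp′)
    expand = solve-∀
    cancel : ∀ (a x y : ℤ) → a + (x - x) - (y - y) ≡ a
    cancel = solve-∀

module DehnSommervilleMinors where

  open Determinants
  open Binomials
  open import Data.Nat as ℕ using (ℕ; zero; suc; _∸_; z≤n; s≤s; _≤_; _<_; ⌊_/2⌋)
  import Data.Nat.Properties as ℕP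
  open import Data.Nat.Combinatorics using (_C_; k>n⇒nCk≡0; nCn≡1)
  open import Data.Integer using (ℤ; +_; _-_; _+_; _*_; 0ℤ)
  import Data.Integer.Properties as ℤP
  open import Data.Integer.Tactic.RingSolver using (solve-∀)
  open import Data.Fin using (Fin; zero; suc; toℕ)
  import Data.Fin.Properties as FinP
  open import Data.Bool using (Bool; true; false)
  open import Data.Vec using (_∷_)
  open import Data.Fin.Subset using (Subset)
  open import Data.Product using (_×_; _,_; Σ)
  open import Data.Sum using (inj₁; inj₂)
  open import Data.Empty using (⊥-elim)
  open import Function using (_∘_)
  open import Function.Bundles using (_⇔_; mk⇔; Equivalence)
  open import Relation.Binary.PropositionalEquality

  factor-vanishes : ∀ {x y : ℤ} → x ≢ 0ℤ → x * y ≡ 0ℤ → y ≡ 0ℤ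
  factor-vanishes {x} x≢0 xy≡0 with ℤP.i*j≡0⇒i≡0∨j≡0 x xy≡0
  ... | inj₁ x≡0 = ⊥-elim (x≢0 x≡0)
  ... | inj₂ y≡0 = y≡0

  nonzero-transfer : ∀ {x y u v : ℤ} → x ≢ 0ℤ → y ≢ 0ℤ → x * u ≡ y * v → (u ≢ 0ℤ ⇔ v ≢ 0ℤ)
  nonzero-transfer {x} {y} x≢0 y≢0 xu≡yv = mk⇔
    (λ u≢0 v≡0 → u≢0 (factor-vanishes x≢0 (trans xu≡yv (trans (cong (y *_) v≡0) (ℤP.*-zeroʳ y)))))
    (λ v≢0 u≡0 → v≢0 (factor-vanishes y≢0 (trans (sym xu≡yv) (trans (cong (x *_) u≡0) (ℤP.*-zeroʳ x)))))

  entry : ℕ → ℕ → ℕ → ℤ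
  entry d i j = + ((suc d ∸ i) C (suc d ∸ j)) - + (i C (suc d ∸ j))

  entry-origin : ∀ d → entry d 0 0 ≡ + 1
  entry-origin d = cong₂ (λ x y → + x - + y) (nCn≡1 (suc d)) (k>n⇒nCk≡0 {0} {suc d} (s≤s z≤n))

  entry-first-column : ∀ d r → r < d → entry d (suc r) 0 ≡ 0ℤ
  entry-first-column d r r<d = cong₂ (λ x y → + x - + y)
    (k>n⇒nCk≡0 (s≤s (ℕP.m∸n≤m d r)))
    (k>n⇒nCk≡0 (s≤s r<d))

  entry-middle-row : ∀ d i j → suc d ∸ i ≡ i → entry d i j ≡ 0ℤ
  entry-middle-row d i j middle = trans (cong (λ t → + (t C (suc d ∸ j)) - + (i C (suc d ∸ j))) middle)
                                        (ℤP.+-inverseʳ (+ (i C (suc d ∸ j))))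

  entry-recurrence : ∀ d r j → r ≤ d → j ≤ suc d →
    entry (suc d) (suc r) (suc j) * + suc j ≡ + suc r * entry d r j + + (suc d ∸ r) * entry d (suc r) j
  entry-recurrence d r j r≤d j≤1+d rewrite ℕP.+-∸-assoc 1 r≤d =
    binomial-difference (d ∸ r) r (suc d ∸ j) (suc j) sizes
    where
    sizes : suc j ℕ.+ (suc d ∸ j) ≡ suc (d ∸ r) ℕ.+ suc r
    sizes = trans (cong suc (ℕP.m+[n∸m]≡n j≤1+d))
                  (cong suc (trans (cong suc (sym (ℕP.m∸n+n≡m r≤d))) (sym (ℕP.+-suc (d ∸ r) r))))

  -- Likewise row 0 of M_{d+1}, after the same scaling, becomes (d+2)·(row 0 of M_d);
  -- here the second binomial term vanishes and absorption alone suffices.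
  entry-recurrence-top : ∀ d j → j ≤ d → entry (suc d) 0 (suc j) * + suc j ≡ + suc (suc d) * entry d 0 j
  entry-recurrence-top d j j≤d rewrite ℕP.+-∸-assoc 1 j≤d = begin
      (X′ - + 0) * + suc j
    ≡⟨ cong ((X′ - + 0) *_) (pos-difference (suc j) K _ sizes) ⟩
      (X′ - + 0) * (D - k)
    ≡⟨ expand D k X X′ ⟩
      D * (X - + 0) - (D * X + k * X′ - D * X′)
    ≡⟨ cong (λ t → D * (X - + 0) - (t - D * X′)) (absorption-sumℤ (suc d) K) ⟩
      D * (X - + 0) - (D * X′ - D * X′)
    ≡⟨ cancel (D * (X - + 0)) (D * X′) ⟩
      D * (X - + 0)
    ∎
    where
    open ≡-Reasoning
    K : ℕ
    K = suc (d ∸ j)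
    D k X X′ : ℤ
    D = + suc (suc d)
    k = + K
    X = + (suc d C K)
    X′ = + (suc (suc d) C K)
    sizes : suc j ℕ.+ K ≡ suc (suc d)
    sizes = cong suc (trans (ℕP.+-suc j (d ∸ j)) (cong suc (ℕP.m+[n∸m]≡n j≤d)))
    expand : ∀ (D k X X′ : ℤ) → (X′ - + 0) * (D - k) ≡ D * (X - + 0) - (D * X + k * X′ - D * X′)
    expand = solve-∀
    cancel : ∀ (a x : ℤ) → a - (x - x) ≡ a
    cancel = solve-∀

  -- The dimensions 2n and 2n−1 for n = m+1.
  dEven dOdd : ℕ → ℕ
  dEven m = suc (suc (2 ℕ.* m))
  dOdd  m = suc (2 ℕ.* m)

  columnMinor : ∀ d {n} → (Fin n → Fin (suc d)) → Matrix n
  columnMinor d col r c = entry d (toℕ r) (toℕ (col c))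

  -- The column weights j+1 of the recurrence.
  weight : ∀ {n d} → (Fin n → Fin (suc d)) → Fin n → ℤ
  weight col c = + suc (toℕ (col c))

  weight-nonzero : ∀ {n d} (col : Fin n → Fin (suc d)) → prodFin n (weight col) ≢ 0ℤ
  weight-nonzero {n} col = prodFin-nonzero n (weight col) (λ c ())

  -- Row n of M_{2n−1} is its vanishing middle row.
  dOdd-middle : ∀ m → suc (dOdd m) ∸ suc m ≡ suc m
  dOdd-middle m = trans (ℕP.+-∸-assoc 1 (ℕP.m≤m+n m (m ℕ.+ 0)))
                        (cong suc (trans (ℕP.m+n∸m≡n m (m ℕ.+ 0)) (ℕP.+-identityʳ m)))

  m≤dOdd : ∀ m → m ≤ dOdd m
  m≤dOdd m = ℕP.m≤n⇒m≤1+n (ℕP.m≤m+n m (m ℕ.+ 0))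

  -- A basis of DS_{2n} containing label 1: its minor reduces, by the unit first column, column
  -- scaling and row reduction along the recurrence, to the minor of M_{2n−1} on the other columns:
  --   (∏ (col c + 1)) · det(minor of M_{2n}) = n! · det(minor of M_{2n−1}).
  minor-with-first-column : ∀ m {n} (col : Fin n → Fin (suc (dOdd m))) → n ≡ suc m →
    prodFin n (weight col) * det (suc n) (columnMinor (dEven m) (lift col))
      ≡ prodUpTo n (λ r → + suc r) * det n (columnMinor (dOdd m) col)
  minor-with-first-column m col refl = begin
      prodFin (suc m) (weight col) * det (suc (suc m)) (columnMinor (dEven m) (lift col))
    ≡⟨ cong (prodFin (suc m) (weight col) *_)
            (det-unit-first-column (suc m) (columnMinor (dEven m) (lift col)) (entry-origin (dEven m))
               (λ r → entry-first-column (dEven m) (toℕ r)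
                        (s≤s (ℕP.≤-trans (FinP.toℕ≤pred[n] r) (m≤dOdd m))))) ⟩
      prodFin (suc m) (weight col) * det (suc m) shifted
    ≡⟨ sym (det-scale-columns (suc m) shifted (weight col)) ⟩
      det (suc m) (λ r c → shifted r c * weight col c)
    ≡⟨ det-cong (suc m) (λ r c → entry-recurrence (dOdd m) (toℕ r) (toℕ (col c))
                                   (ℕP.≤-trans (FinP.toℕ≤pred[n] r) (m≤dOdd m)) (FinP.toℕ≤n (col c))) ⟩
      det (suc m) H
    ≡⟨ det-bidiagonal ⟩
      prodUpTo (suc m) b * det (suc m) (columnMinor (dOdd m) col)
    ∎
    where
    open ≡-Reasoning
    shifted : Matrix (suc m)
    shifted r c = entry (dEven m) (suc (toℕ r)) (suc (toℕ (col c)))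
    g : ℕ → Fin (suc m) → ℤ
    g r c = entry (dOdd m) r (toℕ (col c))
    a b : ℕ → ℤ
    a r = + (dEven m ∸ r)
    b r = + suc r
    open RowReduction g a b (λ c → entry-middle-row (dOdd m) (suc m) (toℕ (col c)) (dOdd-middle m))

  -- A set of n+1 columns of M_{2n} avoiding column 0 never spans: after column scaling the
  -- recurrence expresses its rows through rows 0, 0, 1, …, n of M_{2n−1}, two of them equal.
  minor-without-first-column : ∀ m {n} (col : Fin n → Fin (suc (dOdd m))) → n ≡ suc (suc m) →
    det n (columnMinor (dEven m) (suc ∘ col)) ≡ 0ℤ
  minor-without-first-column m col refl = factor-vanishes (weight-nonzero col) scaled≡0
    where
    g : ℕ → Fin (suc (suc m)) → ℤ
    g zero    c = entry (dOdd m) 0 (toℕ (col c))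
    g (suc r) c = entry (dOdd m) r (toℕ (col c))
    a b : ℕ → ℤ
    a zero    = 0ℤ
    a (suc r) = + (dEven m ∸ r)
    b zero    = + suc (dEven m)
    b (suc r) = + suc r
    open RowReduction g a b (λ c → entry-middle-row (dOdd m) (suc m) (toℕ (col c)) (dOdd-middle m))
    scaled-rows : ∀ r c → columnMinor (dEven m) (suc ∘ col) r c * weight col c ≡ H r c
    scaled-rows zero    c = trans (entry-recurrence-top (dOdd m) (toℕ (col c)) (FinP.toℕ≤pred[n] (col c)))
                                  (sym (ℤP.+-identityʳ _))
    scaled-rows (suc r) c = entry-recurrence (dOdd m) (toℕ r) (toℕ (col c))
                              (ℕP.≤-trans (FinP.toℕ≤pred[n] r) (m≤dOdd m)) (FinP.toℕ≤n (col c))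
    scaled≡0 : prodFin (suc (suc m)) (weight col) * det (suc (suc m)) (columnMinor (dEven m) (suc ∘ col)) ≡ 0ℤ
    scaled≡0 = begin
        prodFin (suc (suc m)) (weight col) * det (suc (suc m)) (columnMinor (dEven m) (suc ∘ col))
      ≡⟨ sym (det-scale-columns (suc (suc m)) (columnMinor (dEven m) (suc ∘ col)) (weight col)) ⟩
        det (suc (suc m)) (λ r c → columnMinor (dEven m) (suc ∘ col) r c * weight col c)
      ≡⟨ det-cong (suc (suc m)) scaled-rows ⟩
        det (suc (suc m)) H
      ≡⟨ det-bidiagonal ⟩
        prodUpTo (suc (suc m)) b * det (suc (suc m)) G
      ≡⟨ cong (prodUpTo (suc (suc m)) b *_)
              (det-equal-adjacent-rows (suc (suc m)) G zero (suc zero) refl (λ c → refl)) ⟩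
        prodUpTo (suc (suc m)) b * 0ℤ
      ≡⟨ ℤP.*-zeroʳ (prodUpTo (suc (suc m)) b) ⟩
        0ℤ
      ∎
      where open ≡-Reasoning

  -- B is a basis of DS_d iff it has k = rank elements and its columns give a nonzero minor
  -- (taken at size |B|, so that no transport along |B| = k remains).
  basis⇔ : ∀ d k (B : Subset (suc d)) → rk d ≡ k →
    IsBasis d B ⇔ (size B ≡ k × det (size B) (columnMinor d (cols B)) ≢ 0ℤ)
  basis⇔ d _ B refl = at-own-size
    where
    at-own-size : ∀ {k} →
      (Σ (size B ≡ k) λ e → det k (λ i c → entry d (toℕ i) (toℕ (cols B (subst Fin (sym e) c)))) ≢ 0ℤ)
        ⇔ (size B ≡ k × det (size B) (columnMinor d (cols B)) ≢ 0ℤ)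
    at-own-size = mk⇔ (λ { (refl , nonzero) → refl , nonzero }) (λ { (refl , nonzero) → refl , nonzero })

  cols-true : ∀ {n} (B : Subset n) c → cols (true ∷ B) c ≡ lift (cols B) c
  cols-true B zero    = refl
  cols-true B (suc c) = refl

  minor-correspondence : ∀ m (b : Bool) (B : Subset (suc (dOdd m))) →
    (size (b ∷ B) ≡ suc (suc m) × det (size (b ∷ B)) (columnMinor (dEven m) (cols (b ∷ B))) ≢ 0ℤ)
      ⇔ (b ≡ true × (size B ≡ suc m × det (size B) (columnMinor (dOdd m) (cols B)) ≢ 0ℤ))
  minor-correspondence m false B = mk⇔
    (λ (|B|≡ , nonzero) → ⊥-elim (nonzero (minor-without-first-column m (cols B) |B|≡)))
    (λ { (() , _) })
  minor-correspondence m true B = mk⇔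
    (λ (|B|+1≡ , nonzero) → let |B|≡ = ℕP.suc-injective |B|+1≡ in
       refl , |B|≡ , Equivalence.to (transfer |B|≡) nonzero)
    (λ { (refl , |B|≡ , nonzero) → cong suc |B|≡ , Equivalence.from (transfer |B|≡) nonzero })
    where
    transfer : size B ≡ suc m →
      (det (suc (size B)) (columnMinor (dEven m) (cols (true ∷ B))) ≢ 0ℤ)
        ⇔ (det (size B) (columnMinor (dOdd m) (cols B)) ≢ 0ℤ)
    transfer |B|≡ = nonzero-transfer (weight-nonzero (cols B)) (prodUpTo-nonzero (size B) (λ r → + suc r) (λ r _ ()))
      (trans (cong (prodFin (size B) (weight (cols B)) *_)
                   (det-cong (suc (size B)) λ r c → cong (λ j → entry (dEven m) (toℕ r) (toℕ j)) (cols-true B c)))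
             (minor-with-first-column m (cols B) |B|≡))

  rank-even : ∀ m → rk (dEven m) ≡ suc (suc m)
  rank-even m = cong (λ k → suc (suc k))
    (trans (cong (λ t → ⌊ m ℕ.+ t /2⌋) (ℕP.+-identityʳ m)) (sym (ℕP.n≡⌊n+n/2⌋ m)))

  rank-odd : ∀ m → rk (dOdd m) ≡ suc m
  rank-odd m = cong ℕ.suc
    (trans (cong (λ t → ⌊ suc (m ℕ.+ t) /2⌋) (ℕP.+-identityʳ m)) (sym (ℕP.n≡⌈n+n/2⌉ m)))

open import Data.Nat using (ℕ; suc; _*_)
open import Data.Integer using (0ℤ)
open import Data.Bool using (Bool; true)
open import Data.Vec using (_∷_)
open import Data.Fin.Subset using (Subset)
open import Data.Product using (_×_)
open import Data.Product.Function.NonDependent.Propositional using (_×-⇔_)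
open import Function.Bundles using (_⇔_)
open import Function.Construct.Identity using (⇔-id)
open import Function.Construct.Symmetry using (⇔-sym)
open import Function.Properties.Equivalence using (⇔-setoid)
open import Level using (0ℓ)
import Relation.Binary.Reasoning.Setoid as SetoidReasoning
open import Relation.Binary.PropositionalEquality using (_≡_; _≢_)
open DehnSommervilleMinors using (dEven; dOdd; columnMinor; rank-even; rank-odd; basis⇔; minor-correspondence)

lemma3p2 : (m : ℕ) (b : Bool) (B : Subset (suc (suc (2 * m)))) →
    IsBasis (suc (suc (2 * m))) (b ∷ B) ⇔ (b ≡ true × IsBasis (suc (2 * m)) B)
lemma3p2 m b B = begin
    IsBasis (dEven m) (b ∷ B)
  ≈⟨ basis⇔ (dEven m) (suc (suc m)) (b ∷ B) (rank-even m) ⟩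
    (size (b ∷ B) ≡ suc (suc m) × det (size (b ∷ B)) (columnMinor (dEven m) (cols (b ∷ B))) ≢ 0ℤ)
  ≈⟨ minor-correspondence m b B ⟩
    (b ≡ true × (size B ≡ suc m × det (size B) (columnMinor (dOdd m) (cols B)) ≢ 0ℤ))
  ≈⟨ ⇔-id _ ×-⇔ ⇔-sym (basis⇔ (dOdd m) (suc m) B (rank-odd m)) ⟩
    (b ≡ true × IsBasis (dOdd m) B)
  ∎
  where open SetoidReasoning (⇔-setoid 0ℓ)
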